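{- If $H$ is a finite triangle-free graph such that $2m(H)\le |V(H)|-2$, then $|V(H)|\le m(H)+\overline{\Delta_2}(H)+2$.
   Context: $m(H)$ is the matching number of $H$ (maximum size of a matching). For vertices $v,w$, the anti-codegree is $\overline{\operatorname{codeg}}(v,w)=|V(H)\setminus(N(v)\cup N(w)\cup\{v,w\})|$, and $\overline{\Delta_2}(H)=\max_{v,w}\overline{\operatorname{codeg}}(v,w)$. -}

module Defs where

open import Data.Nat using (ℕ; _≤_)
open import Data.Fin using (Fin)
open import Data.List using (List; length; filter; allFin)
open import Data.List.Relation.Unary.AllPairs using (AllPairs)
open import Data.List.Relation.Unary.All using (All)
open import Data.Product using (_×_; _,_; Σ; ∃; proj₁; proj₂)
open import Relation.Nullary using (¬_; Dec)
open import Data.Empty using (⊥)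
open import Relation.Unary using (Decidable)
open import Relation.Binary.PropositionalEquality using (_≡_; _≢_)

record Graph (n : ℕ) : Set₁ where
  field
    Adj     : Fin n → Fin n → Set
    adj?    : (u v : Fin n) → Dec (Adj u v)
    sym     : ∀ {u v} → Adj u v → Adj v u
    irrefl  : ∀ {u} → ¬ Adj u u
open Graph public

module _ {n : ℕ} (H : Graph n) where

  TriangleFree : Set
  TriangleFree = ∀ u v w → Adj H u v → Adj H v w → Adj H u w → ⊥

  Disjoint : (Fin n × Fin n) → (Fin n × Fin n) → Set
  Disjoint (a , b) (c , d) = a ≢ c × a ≢ d × b ≢ c × b ≢ d

  IsMatching : List (Fin n × Fin n) → Set
  IsMatching M = All (λ e → Adj H (proj₁ e) (proj₂ e)) M × AllPairs Disjoint M

  IsMatchingNumber : ℕ → Set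
  IsMatchingNumber k =
    (Σ (List (Fin n × Fin n)) λ M → IsMatching M × length M ≡ k)
    × (∀ M → IsMatching M → length M ≤ k)

  AntiCommon : Fin n → Fin n → Fin n → Set
  AntiCommon v w u = u ≢ v × u ≢ w × ¬ Adj H v u × ¬ Adj H w u

  antiCommon? : (v w : Fin n) → Decidable (AntiCommon v w)
  antiCommon? v w u =
    ¬? (u Fin.≟ v) ×-dec ¬? (u Fin.≟ w) ×-dec ¬? (adj? H v u) ×-dec ¬? (adj? H w u)
    where
      import Data.Fin as Fin
      open import Relation.Nullary.Decidable using (¬?; _×-dec_)

  antiCodeg : Fin n → Fin n → ℕ
  antiCodeg v w = length (filter (antiCommon? v w) (allFin n))

  IsMaxAntiCodeg : ℕ → Set
  IsMaxAntiCodeg k =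
    (Σ (Fin n) λ v → Σ (Fin n) λ w → v ≢ w × antiCodeg v w ≡ k)
    × (∀ v w → v ≢ w → antiCodeg v w ≤ k)

{-# OPTIONS --safe #-}
-- Take a maximum matching M and two distinct unmatched vertices u, v, which
-- exist because 2m(H) ≤ |V(H)| − 2. Every neighbour of u or v is matched, and
-- no edge ab of M has both ends in N(u) ∪ N(v): u ~ a ~ b ~ u would be a
-- triangle and u ~ a, b ~ v an augmenting path. Hence |N(u) ∪ N(v)| ≤ m(H), and
-- every vertex outside {u, v} ∪ N(u) ∪ N(v) is counted by the anti-codegree of u, v.
module Submission where

open import Defs renaming (sym to Adj-sym)
open import Data.Nat using (ℕ; suc; _+_; _*_; _≤_; _<_; z≤n; s≤s)
open import Data.Nat.Properties
  using (≤-reflexive; <⇒≱; +-suc; +-comm; *-suc; +-monoˡ-≤; +-monoʳ-≤; +-cancelʳ-≤; module ≤-Reasoning)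
open import Data.Fin using (Fin) renaming (_≟_ to _≟ᶠ_)
open import Data.List using (List; []; _∷_; length; filter; allFin; map)
open import Data.List.Properties using (filter-notAll; length-tabulate; length-map)
open import Data.List.Relation.Unary.All as All using (All; []; _∷_)
open import Data.List.Relation.Unary.All.Properties using (all-filter)
open import Data.List.Relation.Unary.AllPairs using (_∷_)
open import Data.List.Relation.Unary.Any as Any using (here; there; any?)
open import Data.List.Membership.Propositional using (_∈_; _∉_)
open import Data.List.Membership.Propositional.Properties using (∈-filter⁺; ∈-filter⁻)
open import Data.List.Relation.Binary.Subset.Propositional using (_⊆_)
open import Data.List.Relation.Binary.Subset.Propositional.Properties using (∷⁺ʳ)
open import Data.List.Relation.Unary.Unique.Propositional using (Unique)
import Data.List.Relation.Unary.Unique.Propositional.Properties as Unique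
open import Data.Product using (∃; ∃₂; _×_; _,_; proj₁; proj₂)
open import Data.Sum using (_⊎_; inj₁; inj₂; [_,_]′; fromInj₂)
open import Data.Empty using (⊥)
open import Function using (_∘_)
open import Relation.Nullary using (¬_; yes; no; contradiction)
open import Relation.Nullary.Decidable using (¬?; _⊎-dec_; decidable-stable; toSum)
open import Relation.Unary using (Pred; Decidable)
open import Relation.Unary.Properties using (∁?)
open import Relation.Binary.Definitions using (DecidableEquality)
open import Relation.Binary.PropositionalEquality using (_≡_; _≢_; refl; sym; trans; cong; subst; ≢-sym)

module _ {a} {A : Set a} where

  vertices : List (A × A) → List A
  vertices []             = []
  vertices ((x , y) ∷ es) = x ∷ y ∷ vertices es

  length-vertices : ∀ es → length (vertices es) ≡ 2 * length es
  length-vertices []             = refl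
  length-vertices ((_ , _) ∷ es) = trans (cong (2 +_) (length-vertices es)) (sym (*-suc 2 (length es)))

  ∉-∷⁺ : ∀ {x y : A} {ys} → x ≢ y → x ∉ ys → x ∉ y ∷ ys
  ∉-∷⁺ x≢y _    (here x≡y)   = x≢y x≡y
  ∉-∷⁺ _   x∉ys (there x∈ys) = x∉ys x∈ys

  two-distinct : ∀ {q} {Q : Pred A q} {xs} → Unique xs → All Q xs → 2 ≤ length xs →
                 ∃₂ λ x y → x ≢ y × Q x × Q y
  two-distinct ((x≢y ∷ _) ∷ _) (qx ∷ qy ∷ _) _  = _ , _ , x≢y , qx , qy
  two-distinct {xs = _ ∷ []} _ _ (s≤s ())

  module _ {p} {P : Pred A p} (P? : Decidable P) where

    length-filter+filter-∁ : ∀ xs → length (filter P? xs) + length (filter (∁? P?) xs) ≡ length xs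
    length-filter+filter-∁ []       = refl
    length-filter+filter-∁ (x ∷ xs) with P? x
    ... | yes _ = cong suc (length-filter+filter-∁ xs)
    ... | no  _ = trans (+-suc _ _) (cong suc (length-filter+filter-∁ xs))

    pick : A × A → A
    pick (x , y) with P? x
    ... | yes _ = x
    ... | no  _ = y

    ∈-map-pick : ∀ {es x} → All (λ e → ¬ (P (proj₁ e) × P (proj₂ e))) es →
                 x ∈ vertices es → P x → x ∈ map pick es
    ∈-map-pick {(y , _) ∷ _} _ (here refl) px with P? y
    ... | yes _  = here refl
    ... | no ¬py = contradiction px ¬py
    ∈-map-pick {(y , _) ∷ _} (¬both ∷ _) (there (here refl)) px with P? y
    ... | yes py = contradiction (py , px) ¬both
    ... | no  _  = here refl
    ∈-map-pick (_ ∷ ok) (there (there x∈)) px = there (∈-map-pick ok x∈ px)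

  module _ (_≟_ : DecidableEquality A) where

    Unique-⊆⇒length≤ : ∀ {xs ys} → Unique xs → xs ⊆ ys → length xs ≤ length ys
    Unique-⊆⇒length≤ {[]}          _             _     = z≤n
    Unique-⊆⇒length≤ {x ∷ xs} {ys} (x∉xs ∷ uniq) xs⊆ys = begin
      suc (length xs)                  ≤⟨ s≤s (Unique-⊆⇒length≤ uniq xs⊆ys-x) ⟩
      suc (length (filter ≢x? ys))     ≤⟨ filter-notAll ≢x? ys (Any.map (λ x≡y y≢x → y≢x (sym x≡y)) (xs⊆ys (here refl))) ⟩
      length ys                        ∎
      where
        open ≤-Reasoning
        ≢x? : Decidable (_≢ x)
        ≢x? y = ¬? (y ≟ x)
        xs⊆ys-x : xs ⊆ filter ≢x? ys
        xs⊆ys-x y∈xs = ∈-filter⁺ ≢x? (xs⊆ys (there y∈xs)) (≢-sym (All.lookup x∉xs y∈xs))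

    length≤filter+length : ∀ {p} {P : Pred A p} (P? : Decidable P) {xs ys} → Unique xs →
                           (∀ {x} → x ∈ xs → P x ⊎ x ∈ ys) →
                           length xs ≤ length (filter P? xs) + length ys
    length≤filter+length P? {xs} {ys} uniq covered = begin
      length xs                                           ≡⟨ sym (length-filter+filter-∁ P? xs) ⟩
      length (filter P? xs) + length (filter (∁? P?) xs)  ≤⟨ +-monoʳ-≤ _ (Unique-⊆⇒length≤ (Unique.filter⁺ (∁? P?) uniq) ∁⊆ys) ⟩
      length (filter P? xs) + length ys                   ∎
      where
        open ≤-Reasoning
        ∁⊆ys : filter (∁? P?) xs ⊆ ys
        ∁⊆ys x∈ with ∈-filter⁻ (∁? P?) x∈
        ... | x∈xs , ¬px = fromInj₂ (λ px → contradiction px ¬px) (covered x∈xs)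

module _ {n : ℕ} where

  n≤count+length : ∀ {p} {P : Pred (Fin n) p} (P? : Decidable P) (ys : List (Fin n)) →
                   (∀ x → P x ⊎ x ∈ ys) → n ≤ length (filter P? (allFin n)) + length ys
  n≤count+length P? ys covered =
    subst (_≤ length (filter P? (allFin n)) + length ys) (length-tabulate {n = n} (λ i → i))
          (length≤filter+length _≟ᶠ_ P? (Unique.allFin⁺ n) (λ {x} _ → covered x))

  two-∉ : (xs : List (Fin n)) → length xs + 2 ≤ n → ∃₂ λ u v → u ≢ v × u ∉ xs × v ∉ xs
  two-∉ xs xs+2≤n =
    two-distinct (Unique.filter⁺ ∉? (Unique.allFin⁺ n)) (all-filter ∉? (allFin n)) 2≤#∉
    where
      ∉? : Decidable (_∉ xs)
      ∉? x = ¬? (any? (x ≟ᶠ_) xs)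
      2≤#∉ : 2 ≤ length (filter ∉? (allFin n))
      2≤#∉ = +-cancelʳ-≤ (length xs) 2 _ (begin
        2 + length xs                           ≡⟨ +-comm 2 (length xs) ⟩
        length xs + 2                           ≤⟨ xs+2≤n ⟩
        n                                       ≤⟨ n≤count+length ∉? xs (λ x → [ inj₂ , inj₁ ]′ (toSum (any? (x ≟ᶠ_) xs))) ⟩
        length (filter ∉? (allFin n)) + length xs ∎)
        where open ≤-Reasoning

module _ {n : ℕ} (H : Graph n) where

  ∉vertices⇒All-Disjoint : ∀ {x y M} → x ∉ vertices M → y ∉ vertices M → All (Disjoint H (x , y)) M
  ∉vertices⇒All-Disjoint {M = []}          _  _  = []
  ∉vertices⇒All-Disjoint {M = (_ , _) ∷ _} x∉ y∉ =
    (x∉ ∘ here , x∉ ∘ there ∘ here , y∉ ∘ here , y∉ ∘ there ∘ here)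
    ∷ ∉vertices⇒All-Disjoint (x∉ ∘ there ∘ there) (y∉ ∘ there ∘ there)

  All-Disjoint⇒∉vertices : ∀ {x y M} → All (Disjoint H (x , y)) M → x ∉ vertices M × y ∉ vertices M
  All-Disjoint⇒∉vertices {M = []}          []                              = (λ ()) , (λ ())
  All-Disjoint⇒∉vertices {M = (_ , _) ∷ _} ((x≢c , x≢d , y≢c , y≢d) ∷ disj)
    with All-Disjoint⇒∉vertices disj
  ... | x∉ , y∉ = ∉-∷⁺ x≢c (∉-∷⁺ x≢d x∉) , ∉-∷⁺ y≢c (∉-∷⁺ y≢d y∉)

  Disjoint-sym : ∀ {e f} → Disjoint H e f → Disjoint H f e
  Disjoint-sym {_ , _} {_ , _} (a≢c , a≢d , b≢c , b≢d) = ≢-sym a≢c , ≢-sym b≢c , ≢-sym a≢d , ≢-sym b≢d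

  IsMatching-∷⁺ : ∀ {x y M} → IsMatching H M → Adj H x y → x ∉ vertices M → y ∉ vertices M →
                  IsMatching H ((x , y) ∷ M)
  IsMatching-∷⁺ (adj , disj) xy x∉ y∉ = xy ∷ adj , ∉vertices⇒All-Disjoint x∉ y∉ ∷ disj

  IsMatching-bring-to-front : ∀ {a b M} → IsMatching H M → (a , b) ∈ M →
    ∃ λ R → IsMatching H ((a , b) ∷ R) × length M ≡ suc (length R) × vertices R ⊆ vertices M
  IsMatching-bring-to-front isM (here refl) = _ , isM , refl , there ∘ there
  IsMatching-bring-to-front {M = (c , d) ∷ K} (cd ∷ adjK , cd∦K ∷ disjK) (there ab∈K)
    with IsMatching-bring-to-front (adjK , disjK) ab∈K | All-Disjoint⇒∉vertices cd∦K
  ... | R , (ab ∷ adjR , ab∦R ∷ disjR) , len , R⊆K | c∉K , d∉K =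
    (c , d) ∷ R ,
    (ab ∷ cd ∷ adjR , (Disjoint-sym (All.lookup cd∦K ab∈K) ∷ ab∦R)
                      ∷ ∉vertices⇒All-Disjoint (c∉K ∘ R⊆K) (d∉K ∘ R⊆K) ∷ disjR) ,
    cong suc len ,
    ∷⁺ʳ c (∷⁺ʳ d R⊆K)

  IsMaximumMatching : List (Fin n × Fin n) → Set
  IsMaximumMatching M = IsMatching H M × (∀ M′ → IsMatching H M′ → length M′ ≤ length M)

  module _ {M} (maximum : IsMaximumMatching M) where

    maximum⇒¬longer : ∀ {M′} → length M < length M′ → ¬ IsMatching H M′
    maximum⇒¬longer M<M′ isM′ = <⇒≱ M<M′ (proj₂ maximum _ isM′)

    maximum⇒unmatched-nonadjacent : ∀ {x y} → x ∉ vertices M → y ∉ vertices M → ¬ Adj H x y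
    maximum⇒unmatched-nonadjacent x∉ y∉ xy =
      maximum⇒¬longer (≤-reflexive refl) (IsMatching-∷⁺ (proj₁ maximum) xy x∉ y∉)

    -- Swapping (a , b) for (u , a) and (b , v) would give a larger matching.
    maximum⇒no-augmenting-3-path : ∀ {u v a b} → u ≢ v → u ∉ vertices M → v ∉ vertices M →
                                   (a , b) ∈ M → Adj H u a → Adj H v b → ⊥
    maximum⇒no-augmenting-3-path {u} {v} {a} {b} u≢v u∉ v∉ ab∈M ua vb
      with IsMatching-bring-to-front (proj₁ maximum) ab∈M
    ... | R , (ab ∷ adjR , ab∦R ∷ disjR) , len , R⊆M
      with All-Disjoint⇒∉vertices ab∦R | All.lookup (∉vertices⇒All-Disjoint u∉ v∉) ab∈M
    ... | a∉R , b∉R | _ , u≢b , v≢a , _ =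
      maximum⇒¬longer (≤-reflexive (cong suc len)) (IsMatching-∷⁺ bv∷R ua u∉bv∷R a∉bv∷R)
      where
        a≢b : a ≢ b
        a≢b refl = irrefl H ab
        bv∷R : IsMatching H ((b , v) ∷ R)
        bv∷R = IsMatching-∷⁺ (adjR , disjR) (Adj-sym H vb) b∉R (v∉ ∘ R⊆M)
        u∉bv∷R : u ∉ vertices ((b , v) ∷ R)
        u∉bv∷R = ∉-∷⁺ u≢b (∉-∷⁺ u≢v (u∉ ∘ R⊆M))
        a∉bv∷R : a ∉ vertices ((b , v) ∷ R)
        a∉bv∷R = ∉-∷⁺ a≢b (∉-∷⁺ (≢-sym v≢a) a∉R)

module _ {n : ℕ} (H : Graph n) (triangle-free : TriangleFree H)
         {M} (maximum : IsMaximumMatching H M)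
         {u v : Fin n} (u≢v : u ≢ v) (u∉M : u ∉ vertices M) (v∉M : v ∉ vertices M) where

  InNbhd : Fin n → Set
  InNbhd x = Adj H u x ⊎ Adj H v x

  inNbhd? : Decidable InNbhd
  inNbhd? x = adj? H u x ⊎-dec adj? H v x

  InNbhd⇒matched : ∀ {x} → InNbhd x → x ∈ vertices M
  InNbhd⇒matched {x} adj = decidable-stable (any? (x ≟ᶠ_) (vertices M)) λ x∉M →
    [ maximum⇒unmatched-nonadjacent H maximum u∉M x∉M
    , maximum⇒unmatched-nonadjacent H maximum v∉M x∉M ]′ adj

  matched-adj : ∀ {a b} → (a , b) ∈ M → Adj H a b
  matched-adj = All.lookup (proj₁ (proj₁ maximum))

  edge-¬both-InNbhd : ∀ {a b} → (a , b) ∈ M → ¬ (InNbhd a × InNbhd b)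
  edge-¬both-InNbhd {a} {b} ab∈M (inj₁ ua , inj₁ ub) = triangle-free u a b ua (matched-adj ab∈M) ub
  edge-¬both-InNbhd {a} {b} ab∈M (inj₂ va , inj₂ vb) = triangle-free v a b va (matched-adj ab∈M) vb
  edge-¬both-InNbhd ab∈M (inj₁ ua , inj₂ vb) =
    maximum⇒no-augmenting-3-path H maximum u≢v u∉M v∉M ab∈M ua vb
  edge-¬both-InNbhd ab∈M (inj₂ va , inj₁ ub) =
    maximum⇒no-augmenting-3-path H maximum (≢-sym u≢v) v∉M u∉M ab∈M va ub

  edges-¬both-InNbhd : All (λ e → ¬ (InNbhd (proj₁ e) × InNbhd (proj₂ e))) M
  edges-¬both-InNbhd = All.tabulate λ {(_ , _)} → edge-¬both-InNbhd

  antiCommon⊎covered : ∀ x → AntiCommon H u v x ⊎ x ∈ u ∷ v ∷ map (pick inNbhd?) M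
  antiCommon⊎covered x with x ≟ᶠ u | x ≟ᶠ v | inNbhd? x
  ... | yes x≡u | _       | _       = inj₂ (here x≡u)
  ... | no _    | yes x≡v | _       = inj₂ (there (here x≡v))
  ... | no _    | no _    | yes adj =
    inj₂ (there (there (∈-map-pick inNbhd? edges-¬both-InNbhd (InNbhd⇒matched adj) adj)))
  ... | no x≢u  | no x≢v  | no ¬adj = inj₁ (x≢u , x≢v , ¬adj ∘ inj₁ , ¬adj ∘ inj₂)

  n≤antiCodeg+2+m : n ≤ antiCodeg H u v + (2 + length M)
  n≤antiCodeg+2+m =
    subst (λ k → n ≤ antiCodeg H u v + (2 + k)) (length-map (pick inNbhd?) M)
          (n≤count+length (antiCommon? H u v) _ antiCommon⊎covered)

lemma5p2 : (n : ℕ) (H : Graph n) → TriangleFree H →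
    (m Δ : ℕ) → IsMatchingNumber H m → IsMaxAntiCodeg H Δ →
    2 * m + 2 ≤ n →
    n ≤ m + Δ + 2
lemma5p2 n H triangle-free m Δ ((M , isM , refl) , maxM) (_ , Δ-max) 2m+2≤n
  with two-∉ (vertices M) (subst (λ k → k + 2 ≤ n) (sym (length-vertices M)) 2m+2≤n)
... | u , v , u≢v , u∉M , v∉M = begin
  n                          ≤⟨ n≤antiCodeg+2+m H triangle-free (isM , maxM) u≢v u∉M v∉M ⟩
  antiCodeg H u v + (2 + m)  ≤⟨ +-monoˡ-≤ (2 + m) (Δ-max u v u≢v) ⟩
  Δ + (2 + m)                ≡⟨ +-comm Δ (2 + m) ⟩
  2 + (m + Δ)                ≡⟨ +-comm 2 (m + Δ) ⟩
  m + Δ + 2                  ∎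
  where open ≤-Reasoning
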